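{- For any $\mathbf{CL}$-space $\langle X,\tau^0,\tau^1\rangle$, if $\tau^1\subseteq\tau^0$, then $\langle X,\tau^0,\tau^1\rangle$ is an $\mathbf{IL}$-space.
   Context: $\mathcal{L}(\Box,\rhd)$ has propositional variables, $\top,\bot$, $\neg,\land,\lor,\to$, unary $\Box,\Diamond$ ($\Diamond$ dual of $\Box$) and binary $\rhd$. $\mathbf{CL}$ is the smallest set of formulas containing all propositional tautologies, $\Box(p\to q)\to(\Box p\to\Box q)$, $\Box(\Box p\to p)\to\Box p$, J1: $\Box(p\to q)\to(p\rhd q)$; J2: $(p\rhd q)\land(q\rhd r)\to(p\rhd r)$; J3: $(p\rhd r)\land(q\rhd r)\to((p\lor q)\rhd r)$; J4: $(p\rhd q)\to(\Diamond p\to\Diamond q)$, closed under modus ponens, necessitation and substitution; $\mathbf{IL}$ is the smallest such set also containing J5: $\Diamond p\rhd p$. For a topology $\tau$, $d_\tau(Y)=\{x: \text{every } U\in\tau \text{ containing } x \text{ meets } Y\setminus\{x\}\}$, $cd_\tau(Y)=X\setminus d_\tau(X\setminus Y)$. A bitopological space is $\langle X,\tau^0,\tau^1\rangle$ with $X\ne\varnothing$, $\tau^0,\tau^1$ topologies. $e_{\tau^0,\tau^1}(Y,Z)=\{x:\forall U\in\tau^1[x\in d_{\tau^0}(Y\cap U)\Rightarrow x\in d_{\tau^0}(Z\cap U)]\}$. A valuation $v$ maps formulas to subsets of $X$, Boolean on connectives, with $v(\Box\varphi)=cd_{\tau^0}(v(\varphi))$, $v(\Diamond\varphi)=d_{\tau^0}(v(\varphi))$,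 $v(\varphi\rhd\psi)=e_{\tau^0,\tau^1}(v(\varphi),v(\psi))$. $\mathrm{Log}(X,\tau^0,\tau^1)$ is the set of $\varphi$ with $v(\varphi)=X$ for all $v$. For a logic $L$, an $L$-space is a bitopological space with $L\subseteq\mathrm{Log}(X,\tau^0,\tau^1)$. -}

module Defs where

open import Data.Nat using (ℕ)
open import Data.Bool using (Bool; true; false; not; _∧_; _∨_)
open import Data.Empty using (⊥)
open import Data.Unit using (⊤)
open import Data.Product using (Σ; _×_; _,_)
open import Data.Sum using (_⊎_)
open import Relation.Nullary using (¬_)
open import Relation.Binary.PropositionalEquality using (_≡_; _≢_)

infixr 6 _∧'_
infixr 5 _∨'_
infixr 4 _⇒_
infix 7 _▷_

data Fm : Set where
  var  : ℕ → Fm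
  ⊤'   : Fm
  ⊥'   : Fm
  ¬'_  : Fm → Fm
  _∧'_ : Fm → Fm → Fm
  _∨'_ : Fm → Fm → Fm
  _⇒_  : Fm → Fm → Fm
  □_   : Fm → Fm
  _▷_  : Fm → Fm → Fm

◇_ : Fm → Fm
◇ φ = ¬' (□ (¬' φ))

sub : (ℕ → Fm) → Fm → Fm
sub σ (var n) = σ n
sub σ ⊤' = ⊤'
sub σ ⊥' = ⊥'
sub σ (¬' φ) = ¬' sub σ φ
sub σ (φ ∧' ψ) = sub σ φ ∧' sub σ ψ
sub σ (φ ∨' ψ) = sub σ φ ∨' sub σ ψ
sub σ (φ ⇒ ψ) = sub σ φ ⇒ sub σ ψ
sub σ (□ φ) = □ sub σ φ
sub σ (φ ▷ ψ) = sub σ φ ▷ sub σ ψ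

bev : (Fm → Bool) → Fm → Bool
bev a (var n) = a (var n)
bev a ⊤' = true
bev a ⊥' = false
bev a (¬' φ) = not (bev a φ)
bev a (φ ∧' ψ) = bev a φ ∧ bev a ψ
bev a (φ ∨' ψ) = bev a φ ∨ bev a ψ
bev a (φ ⇒ ψ) = not (bev a φ) ∨ bev a ψ
bev a (□ φ) = a (□ φ)
bev a (φ ▷ ψ) = a (φ ▷ ψ)

Taut : Fm → Set
Taut φ = (a : Fm → Bool) → bev a φ ≡ true

p q r : Fm
p = var 0
q = var 1
r = var 2

data Thm (withJ5 : Bool) : Fm → Set where
  taut : ∀ {φ} → Taut φ → Thm withJ5 φ
  axK  : Thm withJ5 (□ (p ⇒ q) ⇒ (□ p ⇒ □ q))
  axL  : Thm withJ5 (□ (□ p ⇒ p) ⇒ □ p)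
  J1   : Thm withJ5 (□ (p ⇒ q) ⇒ (p ▷ q))
  J2   : Thm withJ5 ((p ▷ q) ∧' (q ▷ r) ⇒ (p ▷ r))
  J3   : Thm withJ5 ((p ▷ r) ∧' (q ▷ r) ⇒ ((p ∨' q) ▷ r))
  J4   : Thm withJ5 ((p ▷ q) ⇒ (◇ p ⇒ ◇ q))
  J5   : withJ5 ≡ true → Thm withJ5 ((◇ p) ▷ p)
  mp   : ∀ {φ ψ} → Thm withJ5 (φ ⇒ ψ) → Thm withJ5 φ → Thm withJ5 ψ
  nec  : ∀ {φ} → Thm withJ5 φ → Thm withJ5 (□ φ)
  subst : ∀ {φ} (σ : ℕ → Fm) → Thm withJ5 φ → Thm withJ5 (sub σ φ)

CL IL : Fm → Set
CL = Thm false
IL = Thm true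

Subset : Set → Set₁
Subset X = X → Set

-- The indexing avoids quantifying over
-- all subsets X → Set (which would raise universe levels).

_⇔ₛ_ : {X : Set} → Subset X → Subset X → Set
U ⇔ₛ V = ∀ x → (U x → V x) × (V x → U x)

record Topology (X : Set) : Set₁ where
  field
    Idx       : Set
    ext       : Idx → Subset X
    Open-univ : Σ Idx (λ o → ext o ⇔ₛ (λ _ → ⊤))
    Open-∩    : ∀ o₁ o₂ → Σ Idx (λ o → ext o ⇔ₛ (λ x → ext o₁ x × ext o₂ x))
    Open-⋃    : (I : Set) (F : I → Idx)
                → Σ Idx (λ o → ext o ⇔ₛ (λ x → Σ I (λ i → ext (F i) x)))
open Topology public

_⊆τ_ : {X : Set} → Topology X → Topology X → Set
τ ⊆τ σ = ∀ (o : Idx τ) → Σ (Idx σ) (λ o' → ext σ o' ⇔ₛ ext τ o)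

d : {X : Set} → Topology X → Subset X → Subset X
d τ Y x = ∀ (o : Idx τ) → ext τ o x → Σ _ (λ y → ext τ o y × Y y × y ≢ x)

cd : {X : Set} → Topology X → Subset X → Subset X
cd τ Y x = ¬ d τ (λ z → ¬ Y z) x

e : {X : Set} → Topology X → Topology X → Subset X → Subset X → Subset X
e τ0 τ1 Y Z x = ∀ (o : Idx τ1) → d τ0 (λ z → Y z × ext τ1 o z) x
                → d τ0 (λ z → Z z × ext τ1 o z) x

⟦_⟧ : {X : Set} → Fm → Topology X → Topology X → (ℕ → Subset X) → Subset X
⟦ var n ⟧ τ0 τ1 v = v n
⟦ ⊤' ⟧ τ0 τ1 v = λ _ → ⊤
⟦ ⊥' ⟧ τ0 τ1 v = λ _ → ⊥
⟦ ¬' φ ⟧ τ0 τ1 v = λ x → ¬ ⟦ φ ⟧ τ0 τ1 v x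
⟦ φ ∧' ψ ⟧ τ0 τ1 v = λ x → ⟦ φ ⟧ τ0 τ1 v x × ⟦ ψ ⟧ τ0 τ1 v x
⟦ φ ∨' ψ ⟧ τ0 τ1 v = λ x → ⟦ φ ⟧ τ0 τ1 v x ⊎ ⟦ ψ ⟧ τ0 τ1 v x
⟦ φ ⇒ ψ ⟧ τ0 τ1 v = λ x → ¬ ⟦ φ ⟧ τ0 τ1 v x ⊎ ⟦ ψ ⟧ τ0 τ1 v x
⟦ □ φ ⟧ τ0 τ1 v = cd τ0 (⟦ φ ⟧ τ0 τ1 v)
⟦ φ ▷ ψ ⟧ τ0 τ1 v = e τ0 τ1 (⟦ φ ⟧ τ0 τ1 v) (⟦ ψ ⟧ τ0 τ1 v)

InLog : (X : Set) → Topology X → Topology X → Fm → Set₁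
InLog X τ0 τ1 φ = (v : ℕ → Subset X) (x : X) → ⟦ φ ⟧ τ0 τ1 v x

-- L-space (X nonempty)
IsSpace : (Fm → Set) → (X : Set) → Topology X → Topology X → Set₁
IsSpace L X τ0 τ1 = X × (∀ φ → L φ → InLog X τ0 τ1 φ)

module Submission where

-- Löb's axiom makes the derived-set operator of τ⁰ transitive: d (d Y) ⊆ d Y.  For an
-- open U of τ¹, hence of τ⁰, we have d Y ∩ U ⊆ d (Y ∩ U), so
-- d (d Y ∩ U) ⊆ d (d (Y ∩ U)) ⊆ d (Y ∩ U), which is the validity of J5 ◇p ▷ p.
-- The remaining axioms of IL are those of CL, and validity is preserved by the rules.

open import Defs
open import Level using (0ℓ)
open import Axiom.ExcludedMiddle using (ExcludedMiddle)
open import Axiom.DoubleNegationElimination using (DoubleNegationElimination; em⇒dne)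
open import Data.Nat using (ℕ)
open import Data.Product using (Σ; _×_; _,_; proj₁; proj₂)
open import Data.Sum using (_⊎_; inj₁; inj₂)
open import Data.Unit using (tt)
open import Data.Empty using (⊥-elim)
open import Function using (id)
open import Function.Bundles using (_⇔_; mk⇔; Equivalence)
open import Relation.Nullary using (¬_)

open Equivalence using (to; from)

¬⊎-mp : {A B : Set} → ¬ A ⊎ B → A → B
¬⊎-mp (inj₁ ¬a) a = ⊥-elim (¬a a)
¬⊎-mp (inj₂ b) _ = b

→⇒¬⊎ : DoubleNegationElimination 0ℓ → {A B : Set} → (A → B) → ¬ A ⊎ B
→⇒¬⊎ dne f = dne (λ k → k (inj₁ (λ a → k (inj₂ (f a)))))

IsOpen : {X : Set} → Topology X → Subset X → Set
IsOpen τ U = Σ (Idx τ) (λ o → ext τ o ⇔ₛ U)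

module _ {X : Set} where

  d-mono : (τ : Topology X) {A B : Subset X} → (∀ y → A y → B y) → ∀ x → d τ A x → d τ B x
  d-mono τ A⊆B x dA o x∈o with dA o x∈o
  ... | y , y∈o , Ay , y≢x = y , y∈o , A⊆B y Ay , y≢x

  cd-mono : (τ : Topology X) {A B : Subset X} → (∀ y → A y → B y) → ∀ x → cd τ A x → cd τ B x
  cd-mono τ A⊆B x cdA d¬B = cdA (d-mono τ (λ y ¬By Ay → ¬By (A⊆B y Ay)) x d¬B)

  e-mono : (τ0 τ1 : Topology X) {Y Y' Z Z' : Subset X}
         → (∀ y → Y' y → Y y) → (∀ y → Z y → Z' y)
         → ∀ x → e τ0 τ1 Y Z x → e τ0 τ1 Y' Z' x
  e-mono τ0 τ1 Y'⊆Y Z⊆Z' x eYZ o dY' =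
    d-mono τ0 (λ y (z , u) → Z⊆Z' y z , u) x
      (eYZ o (d-mono τ0 (λ y (y' , u) → Y'⊆Y y y' , u) x dY'))

  cd-univ : (τ : Topology X) {Y : Subset X} → (∀ y → Y y) → ∀ x → cd τ Y x
  cd-univ τ all-Y x d¬Y with Open-univ τ
  ... | o , o≡X with d¬Y o (proj₂ (o≡X x) tt)
  ... | y , _ , ¬Yy , _ = ¬Yy (all-Y y)

  d-∩-open : (τ : Topology X) {Y U : Subset X} → IsOpen τ U
           → ∀ x → d τ Y x → U x → d τ (λ y → Y y × U y) x
  d-∩-open τ (oU , oU≡U) x dY Ux o x∈o with Open-∩ τ o oU
  ... | o' , o'≡o∩U with dY o' (proj₂ (o'≡o∩U x) (x∈o , proj₂ (oU≡U x) Ux))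
  ... | y , y∈o' , Yy , y≢x =
    let (y∈o , y∈oU) = proj₁ (o'≡o∩U y) y∈o' in
    y , y∈o , (Yy , proj₁ (oU≡U y) y∈oU) , y≢x

  module _ (τ0 τ1 : Topology X) where

    ⟦sub⟧ : (σ : ℕ → Fm) (v : ℕ → Subset X) (φ : Fm) (x : X)
          → ⟦ sub σ φ ⟧ τ0 τ1 v x ⇔ ⟦ φ ⟧ τ0 τ1 (λ n → ⟦ σ n ⟧ τ0 τ1 v) x
    ⟦sub⟧ σ v (var n) x = mk⇔ id id
    ⟦sub⟧ σ v ⊤' x = mk⇔ id id
    ⟦sub⟧ σ v ⊥' x = mk⇔ id id
    ⟦sub⟧ σ v (¬' φ) x = mk⇔ (λ ¬a a → ¬a (from (⟦sub⟧ σ v φ x) a))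
                             (λ ¬a a → ¬a (to (⟦sub⟧ σ v φ x) a))
    ⟦sub⟧ σ v (φ ∧' ψ) x = mk⇔ (λ (a , b) → to (⟦sub⟧ σ v φ x) a , to (⟦sub⟧ σ v ψ x) b)
                               (λ (a , b) → from (⟦sub⟧ σ v φ x) a , from (⟦sub⟧ σ v ψ x) b)
    ⟦sub⟧ σ v (φ ∨' ψ) x =
      mk⇔ (λ { (inj₁ a) → inj₁ (to (⟦sub⟧ σ v φ x) a) ; (inj₂ b) → inj₂ (to (⟦sub⟧ σ v ψ x) b) })
          (λ { (inj₁ a) → inj₁ (from (⟦sub⟧ σ v φ x) a) ; (inj₂ b) → inj₂ (from (⟦sub⟧ σ v ψ x) b) })
    ⟦sub⟧ σ v (φ ⇒ ψ) x =
      mk⇔ (λ { (inj₁ ¬a) → inj₁ (λ a → ¬a (from (⟦sub⟧ σ v φ x) a))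
             ; (inj₂ b) → inj₂ (to (⟦sub⟧ σ v ψ x) b) })
          (λ { (inj₁ ¬a) → inj₁ (λ a → ¬a (to (⟦sub⟧ σ v φ x) a))
             ; (inj₂ b) → inj₂ (from (⟦sub⟧ σ v ψ x) b) })
    ⟦sub⟧ σ v (□ φ) x = mk⇔ (cd-mono τ0 (λ y → to (⟦sub⟧ σ v φ y)) x)
                            (cd-mono τ0 (λ y → from (⟦sub⟧ σ v φ y)) x)
    ⟦sub⟧ σ v (φ ▷ ψ) x = mk⇔ (e-mono τ0 τ1 (λ y → from (⟦sub⟧ σ v φ y)) (λ y → to (⟦sub⟧ σ v ψ y)) x)
                              (e-mono τ0 τ1 (λ y → to (⟦sub⟧ σ v φ y)) (λ y → from (⟦sub⟧ σ v ψ y)) x)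

    InLog-mp : ∀ {φ ψ} → InLog X τ0 τ1 (φ ⇒ ψ) → InLog X τ0 τ1 φ → InLog X τ0 τ1 ψ
    InLog-mp ⊨φ⇒ψ ⊨φ v x = ¬⊎-mp (⊨φ⇒ψ v x) (⊨φ v x)

    InLog-nec : ∀ {φ} → InLog X τ0 τ1 φ → InLog X τ0 τ1 (□ φ)
    InLog-nec ⊨φ v = cd-univ τ0 (⊨φ v)

    InLog-sub : ∀ {φ} (σ : ℕ → Fm) → InLog X τ0 τ1 φ → InLog X τ0 τ1 (sub σ φ)
    InLog-sub {φ} σ ⊨φ v x = from (⟦sub⟧ σ v φ x) (⊨φ _ x)

    module _ (dne : DoubleNegationElimination 0ℓ)
             (⊨Löb : InLog X τ0 τ1 (□ (□ p ⇒ p) ⇒ □ p)) where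

      -- Löb's axiom at A = B ∩ cd B; its premise □(□A → A) holds since B ⊆ (cd A → A).
      cd⊆cd∘cd : {B : Subset X} → ∀ x → cd τ0 B x → cd τ0 (cd τ0 B) x
      cd⊆cd∘cd {B} x cdB = cd-mono τ0 (λ _ → proj₂) x cdA
        where
        A : Subset X
        A y = B y × cd τ0 B y

        B⊆cdA⇒A : ∀ y → B y → ¬ cd τ0 A y ⊎ A y
        B⊆cdA⇒A y By = →⇒¬⊎ dne (λ cdAy → By , cd-mono τ0 (λ _ → proj₁) y cdAy)

        cdA : cd τ0 A x
        cdA = ¬⊎-mp (⊨Löb (λ _ → A) x) (cd-mono τ0 B⊆cdA⇒A x cdB)

      d∘d⊆d : {Y : Subset X} → ∀ x → d τ0 (d τ0 Y) x → d τ0 Y x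
      d∘d⊆d {Y} x ddY = dne λ ¬dY →
        let cd¬Y : cd τ0 (λ y → ¬ Y y) x
            cd¬Y = λ d¬¬Y → ¬dY (d-mono τ0 (λ _ → dne) x d¬¬Y)
            dY⊆¬cd¬Y : ∀ y → d τ0 Y y → ¬ cd τ0 (λ z → ¬ Y z) y
            dY⊆¬cd¬Y y dY cd¬Y′ = cd¬Y′ (d-mono τ0 (λ z Yz ¬Yz → ¬Yz Yz) y dY)
        in cd⊆cd∘cd x cd¬Y (d-mono τ0 dY⊆¬cd¬Y x ddY)

      ◇⊆d : ∀ φ v x → ⟦ ◇ φ ⟧ τ0 τ1 v x → d τ0 (⟦ φ ⟧ τ0 τ1 v) x
      ◇⊆d φ v x ◇φ = d-mono τ0 (λ _ → dne) x (dne ◇φ)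

      InLog-J5 : τ1 ⊆τ τ0 → InLog X τ0 τ1 ((◇ p) ▷ p)
      InLog-J5 τ1⊆τ0 v x o dY = d∘d⊆d x (d-mono τ0 ◇∩U⊆d[Y∩U] x dY)
        where
        ◇∩U⊆d[Y∩U] : ∀ y → ⟦ ◇ p ⟧ τ0 τ1 v y × ext τ1 o y → d τ0 (λ z → v 0 z × ext τ1 o z) y
        ◇∩U⊆d[Y∩U] y (◇Yy , Uy) = d-∩-open τ0 (τ1⊆τ0 o) y (◇⊆d p v y ◇Yy) Uy

IL-sound : DoubleNegationElimination 0ℓ → {X : Set} (τ0 τ1 : Topology X)
         → (∀ φ → CL φ → InLog X τ0 τ1 φ) → τ1 ⊆τ τ0 → ∀ φ → IL φ → InLog X τ0 τ1 φ
IL-sound dne τ0 τ1 ⊨CL τ1⊆τ0 = sound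
  where
  sound : ∀ φ → IL φ → InLog _ τ0 τ1 φ
  sound φ (taut t) = ⊨CL φ (taut t)
  sound _ axK = ⊨CL _ axK
  sound _ axL = ⊨CL _ axL
  sound _ J1 = ⊨CL _ J1
  sound _ J2 = ⊨CL _ J2
  sound _ J3 = ⊨CL _ J3
  sound _ J4 = ⊨CL _ J4
  sound _ (J5 _) = InLog-J5 τ0 τ1 dne (⊨CL _ axL) τ1⊆τ0
  sound ψ (mp {φ} f a) = InLog-mp τ0 τ1 {φ} {ψ} (sound _ f) (sound φ a)
  sound _ (nec {φ} a) = InLog-nec τ0 τ1 {φ} (sound φ a)
  sound _ (subst {φ} σ a) = InLog-sub τ0 τ1 {φ} σ (sound φ a)

corollary5p2 : ExcludedMiddle 0ℓ → (X : Set) (τ0 τ1 : Topology X)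
    → IsSpace CL X τ0 τ1 → τ1 ⊆τ τ0 → IsSpace IL X τ0 τ1
corollary5p2 lem X τ0 τ1 (x , ⊨CL) τ1⊆τ0 = x , IL-sound (em⇒dne lem) τ0 τ1 ⊨CL τ1⊆τ0
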